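{- Let $u\in[2]^n$ be a word of length $n$ over $\{1,2\}$ with $1\le m_2(u)\le m_1(u)$. Then $c_2(u^k)=c_2(u)$ for all $k\ge1$.
   Context: $u^k$ denotes $u$ concatenated with itself $k$ times. $P(w)$ is the insertion tableau of $w$ under the Robinson–Schensted–Knuth (row-insertion) correspondence. $m_a(u)$ is the number of occurrences of the letter $a$ in $u$. For a positive integer $a$, $c_a(w)$ is the number of columns of $P(w)$ of length exactly one whose sole entry is $a$. -}

module Defs where

open import Data.Nat using (ℕ; zero; suc; _≤?_; _≟_; _+_)
open import Data.List using (List; []; _∷_; _++_; length; drop; filter; foldl; concat; replicate)
open import Data.Product using (_×_; _,_)
open import Data.Maybe using (Maybe; just; nothing)
open import Relation.Nullary using (yes; no)

-- A semistandard tableau represented as a list of rows (top row first),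
-- each row a weakly increasing list of positive integers.
Tableau : Set
Tableau = List (List ℕ)

insertRow : ℕ → List ℕ → List ℕ × Maybe ℕ
insertRow x [] = x ∷ [] , nothing
insertRow x (y ∷ ys) with suc x ≤? y
... | yes _ = x ∷ ys , just y
... | no _ with insertRow x ys
...   | (ys' , b) = y ∷ ys' , b

insert : ℕ → Tableau → Tableau
insert x [] = (x ∷ []) ∷ []
insert x (r ∷ rs) with insertRow x r
... | (r' , nothing) = r' ∷ rs
... | (r' , just y) = r' ∷ insert y rs

P : List ℕ → Tableau
P w = foldl (λ T x → insert x T) [] w

m : ℕ → List ℕ → ℕ
m a u = length (filter (λ x → x ≟ a) u)

-- c_a(w): number of columns of P(w) of length exactly one whose entry is a.
-- Columns of length one are exactly the cells of the first row lying
-- strictly to the right of the end of the second row.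
secondRowLength : Tableau → ℕ
secondRowLength [] = 0
secondRowLength (_ ∷ []) = 0
secondRowLength (_ ∷ r₂ ∷ _) = length r₂

firstRow : Tableau → List ℕ
firstRow [] = []
firstRow (r ∷ _) = r

c : ℕ → List ℕ → ℕ
c a w = m a (drop (secondRowLength (P w)) (firstRow (P w)))

_^^_ : List ℕ → ℕ → List ℕ
u ^^ k = concat (replicate k u)

data Letter2 : ℕ → Set where
  one : Letter2 1
  two : Letter2 2

{-# OPTIONS --safe #-}
module Submission where

-- Over the alphabet {1,2}, P(w) has first row 1ᵃ2ᵇ and at most one further row, made
-- of 2s and not longer than the block of 1s, so c₂(w) = b. Inserting a 2 appends it to
-- the first row; inserting a 1 turns the first 2 of that row (if any) into a 1 and bumps
-- it down. Hence c₂(w) is the number of 2s of w left unmatched when every 1 cancels the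
-- nearest unmatched 2 before it. Reading u from a starting count x leaves (x ∸ p) + q
-- unmatched 2s, where p − q = m₁(u) − m₂(u) ≥ 0; so q = c₂(u) is a fixed point and
-- reading further copies of u never changes it.

open import Defs
open import Data.Nat using (ℕ; zero; suc; _+_; _∸_; _≤_; _<_; z≤n; s≤s)
open import Data.Nat.Properties
  using (+-suc; +-comm; 0∸n≡0; ∸-+-assoc; m≤n⇒m∸n≡0; m<n⇒m<1+n; ≤-reflexive; ≤-trans; +-monoʳ-≤; +-cancelʳ-≤)
open import Data.List using (List; []; _∷_; _++_; drop; foldl; replicate)
open import Data.List.Properties using (length-replicate)
open import Data.List.Relation.Unary.All using (All; []; _∷_)
open import Data.List.Relation.Unary.All.Properties using (concat⁺; replicate⁺)
open import Data.Product using (_×_; _,_; ∃₂)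
open import Data.Maybe using (just; nothing)
open import Relation.Binary.PropositionalEquality using (_≡_; refl; sym; trans; cong; module ≡-Reasoning)
open ≡-Reasoning

row₁₂ : ℕ → ℕ → List ℕ
row₁₂ a b = replicate a 1 ++ replicate b 2

insertRow-2-twos : ∀ b → insertRow 2 (replicate b 2) ≡ (replicate (suc b) 2 , nothing)
insertRow-2-twos zero = refl
insertRow-2-twos (suc b) rewrite insertRow-2-twos b = refl

insertRow-2 : ∀ a b → insertRow 2 (row₁₂ a b) ≡ (row₁₂ a (suc b) , nothing)
insertRow-2 zero b = insertRow-2-twos b
insertRow-2 (suc a) b rewrite insertRow-2 a b = refl

insertRow-1-ones : ∀ a → insertRow 1 (row₁₂ a 0) ≡ (row₁₂ (suc a) 0 , nothing)
insertRow-1-ones zero = refl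
insertRow-1-ones (suc a) rewrite insertRow-1-ones a = refl

insertRow-1-bumps-2 : ∀ a b → insertRow 1 (row₁₂ a (suc b)) ≡ (row₁₂ (suc a) b , just 2)
insertRow-1-bumps-2 zero b = refl
insertRow-1-bumps-2 (suc a) b rewrite insertRow-1-bumps-2 a b = refl

data Tableau₁₂ : Tableau → ℕ → Set where
  empty : Tableau₁₂ [] 0
  oneRow : ∀ a b → Tableau₁₂ (row₁₂ a b ∷ []) b
  twoRows : ∀ a b d → d < a → Tableau₁₂ (row₁₂ a b ∷ replicate (suc d) 2 ∷ []) b

unmatchedStep : ℕ → ℕ → ℕ
unmatchedStep 2 b = suc b
unmatchedStep _ b = b ∸ 1

unmatched : List ℕ → ℕ → ℕ
unmatched [] b = b
unmatched (x ∷ w) b = unmatched w (unmatchedStep x b)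

insert-Tableau₁₂ : ∀ {x T b} → Letter2 x → Tableau₁₂ T b → Tableau₁₂ (insert x T) (unmatchedStep x b)
insert-Tableau₁₂ two empty = oneRow 0 1
insert-Tableau₁₂ two (oneRow a b) rewrite insertRow-2 a b = oneRow a (suc b)
insert-Tableau₁₂ two (twoRows a b d d<a) rewrite insertRow-2 a b = twoRows a (suc b) d d<a
insert-Tableau₁₂ one empty = oneRow 1 0
insert-Tableau₁₂ one (oneRow a zero) rewrite insertRow-1-ones a = oneRow (suc a) 0
insert-Tableau₁₂ one (oneRow a (suc b)) rewrite insertRow-1-bumps-2 a b = twoRows (suc a) b 0 (s≤s z≤n)
insert-Tableau₁₂ one (twoRows a zero d d<a) rewrite insertRow-1-ones a =
  twoRows (suc a) 0 d (m<n⇒m<1+n d<a)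
insert-Tableau₁₂ one (twoRows a (suc b) d d<a)
  rewrite insertRow-1-bumps-2 a b | insertRow-2-twos (suc d) = twoRows (suc a) b (suc d) (s≤s d<a)

insertAll-Tableau₁₂ : ∀ {T b} {w : List ℕ} → All Letter2 w → Tableau₁₂ T b →
  Tableau₁₂ (foldl (λ T x → insert x T) T w) (unmatched w b)
insertAll-Tableau₁₂ [] t = t
insertAll-Tableau₁₂ (x ∷ xs) t = insertAll-Tableau₁₂ xs (insert-Tableau₁₂ x t)

m-2-twos : ∀ b → m 2 (replicate b 2) ≡ b
m-2-twos zero = refl
m-2-twos (suc b) = cong suc (m-2-twos b)

m-2-drop-row₁₂ : ∀ e a b → e ≤ a → m 2 (drop e (row₁₂ a b)) ≡ b
m-2-drop-row₁₂ zero zero b _ = m-2-twos b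
m-2-drop-row₁₂ zero (suc a) b _ = m-2-drop-row₁₂ zero a b z≤n
m-2-drop-row₁₂ (suc e) (suc a) b (s≤s e≤a) = m-2-drop-row₁₂ e a b e≤a

Tableau₁₂-c₂ : ∀ {T b} → Tableau₁₂ T b → m 2 (drop (secondRowLength T) (firstRow T)) ≡ b
Tableau₁₂-c₂ empty = refl
Tableau₁₂-c₂ (oneRow a b) = m-2-drop-row₁₂ 0 a b z≤n
Tableau₁₂-c₂ (twoRows a b d d<a) rewrite length-replicate (suc d) {2} = m-2-drop-row₁₂ (suc d) a b d<a

c₂≡unmatched : ∀ {w} → All Letter2 w → c 2 w ≡ unmatched w 0
c₂≡unmatched ws = Tableau₁₂-c₂ (insertAll-Tableau₁₂ ws empty)

unmatched-++ : ∀ v w b → unmatched (v ++ w) b ≡ unmatched w (unmatched v b)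
unmatched-++ [] w b = refl
unmatched-++ (x ∷ v) w b = unmatched-++ v w (unmatchedStep x b)

-- p and q are the numbers of 1s and of 2s of u that remain unmatched.
unmatched-affine : ∀ {u} → All Letter2 u →
  ∃₂ λ p q → (∀ x → unmatched u x ≡ x ∸ p + q) × (p + m 2 u ≡ q + m 1 u)
unmatched-affine [] = 0 , 0 , (λ x → +-comm 0 x) , refl
unmatched-affine {1 ∷ u} (one ∷ us) with unmatched-affine us
... | p , q , f , balance =
  suc p , q , (λ x → trans (f (x ∸ 1)) (cong (_+ q) (∸-+-assoc x 1 p))) ,
  trans (cong suc balance) (sym (+-suc q (m 1 u)))
unmatched-affine {2 ∷ u} (two ∷ us) with unmatched-affine us
... | zero , q , f , balance = 0 , suc q , (λ x → trans (f (suc x)) (sym (+-suc x q))) , cong suc balance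
... | suc p , q , f , balance = p , q , (λ x → f (suc x)) , trans (+-suc p (m 2 u)) balance

unmatched-fixed : ∀ {u} → All Letter2 u → m 2 u ≤ m 1 u → unmatched u (unmatched u 0) ≡ unmatched u 0
unmatched-fixed {u} us m₂≤m₁ with unmatched-affine us
... | p , q , f , balance = begin
  unmatched u (unmatched u 0) ≡⟨ cong (unmatched u) from-0 ⟩
  unmatched u q               ≡⟨ f q ⟩
  q ∸ p + q                   ≡⟨ cong (_+ q) (m≤n⇒m∸n≡0 q≤p) ⟩
  q                           ≡⟨ from-0 ⟨
  unmatched u 0               ∎
  where
  from-0 : unmatched u 0 ≡ q
  from-0 = trans (f 0) (cong (_+ q) (0∸n≡0 p))
  q≤p : q ≤ p
  q≤p = +-cancelʳ-≤ (m 1 u) q p (≤-trans (≤-reflexive (sym balance)) (+-monoʳ-≤ p m₂≤m₁))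

unmatched-^^-fixed : ∀ u {t} → unmatched u t ≡ t → ∀ k → unmatched (u ^^ k) t ≡ t
unmatched-^^-fixed u fixed zero = refl
unmatched-^^-fixed u {t} fixed (suc k) = begin
  unmatched (u ++ u ^^ k) t          ≡⟨ unmatched-++ u (u ^^ k) t ⟩
  unmatched (u ^^ k) (unmatched u t) ≡⟨ cong (unmatched (u ^^ k)) fixed ⟩
  unmatched (u ^^ k) t               ≡⟨ unmatched-^^-fixed u fixed k ⟩
  t                                  ∎

All-^^ : ∀ {u} → All Letter2 u → ∀ k → All Letter2 (u ^^ k)
All-^^ us k = concat⁺ (replicate⁺ k us)

lemma2p12 : (u : List ℕ) → All Letter2 u → 1 ≤ m 2 u → m 2 u ≤ m 1 u →
    (k : ℕ) → 1 ≤ k → c 2 (u ^^ k) ≡ c 2 u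
lemma2p12 u us _ m₂≤m₁ (suc k) _ = begin
  c 2 (u ++ u ^^ k)                  ≡⟨ c₂≡unmatched (All-^^ us (suc k)) ⟩
  unmatched (u ++ u ^^ k) 0          ≡⟨ unmatched-++ u (u ^^ k) 0 ⟩
  unmatched (u ^^ k) (unmatched u 0) ≡⟨ unmatched-^^-fixed u (unmatched-fixed us m₂≤m₁) k ⟩
  unmatched u 0                      ≡⟨ c₂≡unmatched us ⟨
  c 2 u                              ∎
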